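{- Suppose $L$ is accepted by a DFA with $n$ states and $L$ is not factor-convex. Then there exists a witness $(u,v,w)$ to the failure of factor-convexity of $L$ with $|w| \le 3n^3 + n^2 + n - 1$.
   Context: A word $u$ is a factor of $v$ if $v = xuy$ for some words $x,y$. A witness to the failure of factor-convexity of $L$ is a triple $(u,v,w)$ with $u,w \in L$, $v \notin L$, $u$ a factor of $v$ and $v$ a factor of $w$; $L$ is factor-convex iff no witness exists. -}

module Defs where

open import Data.Nat using (ℕ)
open import Data.Fin using (Fin)
open import Data.Bool using (Bool; true)
open import Data.List using (List; []; _∷_; _++_; foldl)
open import Data.Product using (∃₂; _×_)
open import Relation.Binary.PropositionalEquality using (_≡_)
open import Relation.Nullary using (¬_)

record DFA (A : Set) (n : ℕ) : Set where
  field
    start  : Fin n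
    δ      : Fin n → A → Fin n
    final  : Fin n → Bool

δ* : ∀ {A n} → DFA A n → Fin n → List A → Fin n
δ* M q w = foldl (DFA.δ M) q w

Accepts : ∀ {A n} → DFA A n → List A → Set
Accepts M w = DFA.final M (δ* M (DFA.start M) w) ≡ true

Factor : ∀ {A : Set} → List A → List A → Set
Factor u v = ∃₂ λ x y → v ≡ x ++ (u ++ y)

Witness : ∀ {A : Set} → (List A → Set) → List A → List A → List A → Set
Witness L u v w = L u × L w × ¬ L v × Factor u v × Factor v w

FactorConvex : ∀ {A : Set} → (List A → Set) → Set
FactorConvex L = ∀ u v w → ¬ Witness L u v w

-- Write w = x p u q y with v = p u q.  Each segment is crossed by the runs
-- of the automaton on those of u, v, w that contain it: one run on x and y,
-- two on p and q, three on u.  Cutting out a loop of the product of these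
-- runs preserves acceptance of u, v and w, so the segments can be made
-- shorter than n, n², n³, n², n respectively.  Constructively, ¬ FactorConvex
-- yields such a short witness because bounded search makes its existence
-- decidable.
module Submission where

open import Defs
open import Data.Nat using (ℕ; zero; suc; _≤_; _<_; _+_; _*_; _∸_; _^_; _≤?_; s≤s; z≤n)
open import Data.Nat.Properties
open import Data.Nat.Induction using (<-wellFounded)
open import Data.Nat.Solver using (module +-*-Solver)
open import Data.Fin using (Fin; toℕ; combine)
import Data.Fin.Properties as Finₚ
open import Data.Fin.Patterns using (0F; 1F; 2F)
open import Data.List using (List; []; _∷_; _++_; length; foldl; take; drop)
open import Data.List.Properties using (foldl-++; length-++; length-take; length-drop; take++drop≡id)
open import Data.Vec as Vec using (Vec; []; _∷_; lookup)
open import Data.Vec.Properties using (map-id; map-∘; lookup-map)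
open import Data.Product using (Σ; _×_; _,_; ∃; ∃-syntax)
open import Data.Sum using (_⊎_; inj₁; inj₂)
open import Data.Bool using (true)
import Data.Bool.Properties as Bool
open import Function using (_∘_)
open import Function.Bundles using (_↣_; mk↣; Injection)
open import Function.Definitions using (Injective)
open import Induction.WellFounded using (Acc; acc)
open import Relation.Nullary using (¬_; Dec; yes; no; ¬?)
open import Relation.Nullary.Decidable using (_×-dec_; _⊎-dec_; map′; decidable-stable)
open import Relation.Unary using (Decidable)
open import Relation.Binary.PropositionalEquality

module LoopRemoval {A S : Set} {N : ℕ} (enc : S ↣ Fin N) (t : S → A → S) where

  length-take++drop : ∀ {i j} (w : List A) → i < j → j ≤ length w →
                      length (take i w ++ drop j w) < length w
  length-take++drop {i} {j} w i<j j≤w = begin-strict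
    length (take i w ++ drop j w)          ≡⟨ length-++ (take i w) ⟩
    length (take i w) + length (drop j w)  ≡⟨ cong₂ _+_ |take| (length-drop j w) ⟩
    i + (length w ∸ j)                     <⟨ +-monoˡ-< (length w ∸ j) i<j ⟩
    j + (length w ∸ j)                     ≡⟨ m+[n∸m]≡n j≤w ⟩
    length w                               ∎
    where
    open ≤-Reasoning
    |take| : length (take i w) ≡ i
    |take| = trans (length-take i w) (m≤n⇒m⊓n≡m (<⇒≤ (<-≤-trans i<j j≤w)))

  foldl-take++drop : ∀ s i j (w : List A) →
                     foldl t s (take i w) ≡ foldl t s (take j w) →
                     foldl t s (take i w ++ drop j w) ≡ foldl t s w
  foldl-take++drop s i j w same = begin
    foldl t s (take i w ++ drop j w)            ≡⟨ foldl-++ t s (take i w) (drop j w) ⟩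
    foldl t (foldl t s (take i w)) (drop j w)   ≡⟨ cong (λ s′ → foldl t s′ (drop j w)) same ⟩
    foldl t (foldl t s (take j w)) (drop j w)   ≡⟨ foldl-++ t s (take j w) (drop j w) ⟨
    foldl t s (take j w ++ drop j w)            ≡⟨ cong (foldl t s) (take++drop≡id j w) ⟩
    foldl t s w                                 ∎
    where open ≡-Reasoning

  -- Among the N + 1 prefixes of length ≤ N two reach the same state.
  remove-loop : ∀ s (w : List A) → N ≤ length w →
                ∃ λ w′ → length w′ < length w × foldl t s w′ ≡ foldl t s w
  remove-loop s w N≤w
    with i , j , i<j , same ←
           Finₚ.pigeonhole (n<1+n N) (λ k → Injection.to enc (foldl t s (take (toℕ k) w)))
    = take (toℕ i) w ++ drop (toℕ j) w
    , length-take++drop w i<j (≤-trans (Finₚ.toℕ≤pred[n] j) N≤w)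
    , foldl-take++drop s (toℕ i) (toℕ j) w (Injection.injective enc same)

  short-run : ∀ s (w : List A) → ∃ λ w′ → length w′ < N × foldl t s w′ ≡ foldl t s w
  short-run s w = go w (<-wellFounded (length w))
    where
    go : ∀ w → Acc _<_ (length w) → ∃ λ w′ → length w′ < N × foldl t s w′ ≡ foldl t s w
    go w (acc rec) with N ≤? length w
    ... | no w<N = w , ≰⇒> w<N , refl
    ... | yes N≤w with w₁ , w₁<w , w₁≈w ← remove-loop s w N≤w
                  with w₂ , w₂<N , w₂≈w₁ ← go w₁ (rec w₁<w)
                  = w₂ , w₂<N , trans w₂≈w₁ w₁≈w

encode : ∀ {n r} → Vec (Fin n) r → Fin (n ^ r)
encode []       = 0F
encode (q ∷ qs) = combine q (encode qs)

encode-injective : ∀ {n r} → Injective _≡_ _≡_ (encode {n} {r})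
encode-injective {x = []}     {[]}     _  = refl
encode-injective {x = q ∷ qs} {p ∷ ps} eq
  with q≡p , qs≡ps ← Finₚ.combine-injective q (encode qs) p (encode ps) eq
  = cong₂ _∷_ q≡p (encode-injective qs≡ps)

module _ {A : Set} {n : ℕ} (M : DFA A n) where

  open DFA M

  -- A record rather than an equation, so that q, w′ and w can be inferred.
  infix 4 _≈[_]_
  record _≈[_]_ (w′ : List A) (q : Fin n) (w : List A) : Set where
    constructor same-state
    field δ*-≡ : δ* M q w′ ≡ δ* M q w

  ≈-++ : ∀ {q u′ u v′ v} → u′ ≈[ q ] u → v′ ≈[ δ* M q u ] v → u′ ++ v′ ≈[ q ] u ++ v
  ≈-++ {q} {u′} {u} {v′} {v} (same-state u′≈u) (same-state v′≈v) = same-state (begin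
    δ* M q (u′ ++ v′)       ≡⟨ foldl-++ δ q u′ v′ ⟩
    δ* M (δ* M q u′) v′     ≡⟨ cong (λ r → δ* M r v′) u′≈u ⟩
    δ* M (δ* M q u) v′      ≡⟨ v′≈v ⟩
    δ* M (δ* M q u) v       ≡⟨ foldl-++ δ q u v ⟨
    δ* M q (u ++ v)         ∎)
    where open ≡-Reasoning

  ≈-sym : ∀ {q w′ w} → w′ ≈[ q ] w → w ≈[ q ] w′
  ≈-sym (same-state w′≈w) = same-state (sym w′≈w)

  ≈-Accepts : ∀ {w′ w} → w′ ≈[ start ] w → Accepts M w → Accepts M w′
  ≈-Accepts (same-state w′≈w) = trans (cong final w′≈w)

  δⁿ : ∀ {r} → Vec (Fin n) r → A → Vec (Fin n) r
  δⁿ qs a = Vec.map (λ q → δ q a) qs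

  foldl-δⁿ : ∀ {r} (qs : Vec (Fin n) r) w → foldl δⁿ qs w ≡ Vec.map (λ q → δ* M q w) qs
  foldl-δⁿ qs []      = sym (map-id qs)
  foldl-δⁿ qs (a ∷ w) = trans (foldl-δⁿ (δⁿ qs a) w) (sym (map-∘ _ _ qs))

  synchronised-shortening :
    ∀ {r} (qs : Vec (Fin n) r) w →
    ∃ λ w′ → length w′ < n ^ r × ∀ i → w′ ≈[ lookup qs i ] w
  synchronised-shortening qs w
    with w′ , w′<nʳ , w′≈w ← LoopRemoval.short-run (mk↣ encode-injective) δⁿ qs w
    = w′ , w′<nʳ , λ i → same-state (begin
      δ* M (lookup qs i) w′                          ≡⟨ lookup-map i _ qs ⟨
      lookup (Vec.map (λ q → δ* M q w′) qs) i        ≡⟨ cong (λ rs → lookup rs i) (foldl-δⁿ qs w′) ⟨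
      lookup (foldl δⁿ qs w′) i                      ≡⟨ cong (λ rs → lookup rs i) w′≈w ⟩
      lookup (foldl δⁿ qs w) i                       ≡⟨ cong (λ rs → lookup rs i) (foldl-δⁿ qs w) ⟩
      lookup (Vec.map (λ q → δ* M q w) qs) i         ≡⟨ lookup-map i _ qs ⟩
      δ* M (lookup qs i) w                           ∎)
    where open ≡-Reasoning

  ShortSegmentation : Set
  ShortSegmentation =
    ∃[ x ] length x < n ^ 1 × ∃[ p ] length p < n ^ 2 × ∃[ u ] length u < n ^ 3 ×
    ∃[ q ] length q < n ^ 2 × ∃[ y ] length y < n ^ 1 ×
    Witness (Accepts M) u (p ++ u ++ q) (x ++ (p ++ u ++ q) ++ y)

  shorten : ∀ {u v w} → Witness (Accepts M) u v w → ShortSegmentation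
  shorten {u} (u∈L , w∈L , v∉L , (p , q , refl) , (x , y , refl)) =
    let x′ , |x′|<n  , x′≈x = synchronised-shortening (start ∷ []) x
        p′ , |p′|<n² , p′≈p = synchronised-shortening (start ∷ sx ∷ []) p
        u′ , |u′|<n³ , u′≈u = synchronised-shortening (start ∷ sp ∷ sxp ∷ []) u
        q′ , |q′|<n² , q′≈q = synchronised-shortening (spu ∷ sxpu ∷ []) q
        y′ , |y′|<n  , y′≈y = synchronised-shortening (sxv ∷ []) y
        v′≈v = ≈-++ (p′≈p 0F) (≈-++ (u′≈u 1F) (q′≈q 0F))
        w′≈w = ≈-++ (x′≈x 0F)
                 (≈-++ (≈-++ (p′≈p 1F) (≈-++ (u′≈u 2F) (q′≈q 1F))) (y′≈y 0F))
    in x′ , |x′|<n , p′ , |p′|<n² , u′ , |u′|<n³ , q′ , |q′|<n² , y′ , |y′|<n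
     , ≈-Accepts (u′≈u 0F) u∈L , ≈-Accepts w′≈w w∈L , v∉L ∘ ≈-Accepts (≈-sym v′≈v)
     , (p′ , q′ , refl) , (x′ , y′ , refl)
    where
    -- the state reached from start on reading the segments in the subscript
    sx    = δ* M start x
    sp    = δ* M start p
    sxp   = δ* M sx p
    spu   = δ* M sp u
    sxpu  = δ* M sxp u
    sxv   = δ* M sx (p ++ u ++ q)

  accepts? : Decidable (Accepts M)
  accepts? w = final (δ* M start w) Bool.≟ true

module _ {k : ℕ} where

  search< : ∀ m {P : List (Fin k) → Set} → Decidable P → Dec (∃ λ w → length w < m × P w)
  search< zero    P? = no λ ()
  search< (suc m) {P} P? =
    map′ to from (P? [] ⊎-dec Finₚ.any? λ a → search< m (P? ∘ (a ∷_)))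
    where
    to : P [] ⊎ (∃ λ a → ∃ λ w → length w < m × P (a ∷ w)) → ∃ λ w → length w < suc m × P w
    to (inj₁ P[])               = [] , s≤s z≤n , P[]
    to (inj₂ (a , w , w<m , P)) = a ∷ w , s≤s w<m , P
    from : (∃ λ w → length w < suc m × P w) → P [] ⊎ (∃ λ a → ∃ λ w → length w < m × P (a ∷ w))
    from ([]    , _         , P[]) = inj₁ P[]
    from (a ∷ w , s≤s w<m   , P)   = inj₂ (a , w , w<m , P)

  short-segmentation? : ∀ {n} (M : DFA (Fin k) n) → Dec (ShortSegmentation M)
  short-segmentation? {n} M =
    search< (n ^ 1) λ x → search< (n ^ 2) λ p → search< (n ^ 3) λ u →
    search< (n ^ 2) λ q → search< (n ^ 1) λ y →
    accepts? M u ×-dec accepts? M (x ++ (p ++ u ++ q) ++ y) ×-dec ¬? (accepts? M (p ++ u ++ q))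
      ×-dec yes (p , q , refl) ×-dec yes (x , y , refl)

segments-bound : ∀ n {a b c d e} → a < n ^ 1 → b < n ^ 2 → c < n ^ 3 → d < n ^ 2 → e < n ^ 1 →
                 a + ((b + (c + d)) + e) + 1 ≤ 3 * n ^ 3 + n ^ 2 + n
segments-bound zero ()
segments-bound n@(suc _) {a} {b} {c} {d} {e} a< b< c< d< e< = begin
  a + ((b + (c + d)) + e) + 1                  ≡⟨ +-comm _ 1 ⟩
  suc (a + ((b + (c + d)) + e))                ≤⟨ +-mono-< a< (+-mono-< (+-mono-< b< (+-mono-< c< d<)) e<) ⟩
  n ^ 1 + ((n ^ 2 + (n ^ 3 + n ^ 2)) + n ^ 1)  ≤⟨ +-mono-≤ n≤n³ (+-monoˡ-≤ (n ^ 1) (+-monoˡ-≤ _ n²≤n³)) ⟩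
  n ^ 3 + ((n ^ 3 + (n ^ 3 + n ^ 2)) + n ^ 1)  ≡⟨ collect n ⟩
  3 * n ^ 3 + n ^ 2 + n                        ∎
  where
  open ≤-Reasoning
  open +-*-Solver
  n≤n³ : n ^ 1 ≤ n ^ 3
  n≤n³ = ^-monoʳ-≤ n {1} {3} (s≤s z≤n)
  n²≤n³ : n ^ 2 ≤ n ^ 3
  n²≤n³ = ^-monoʳ-≤ n {2} {3} (s≤s (s≤s z≤n))
  collect : ∀ n → n ^ 3 + ((n ^ 3 + (n ^ 3 + n ^ 2)) + n ^ 1) ≡ 3 * n ^ 3 + n ^ 2 + n
  collect = solve 1 (λ n → n :^ 3 :+ ((n :^ 3 :+ (n :^ 3 :+ n :^ 2)) :+ n :^ 1)
                           := con 3 :* n :^ 3 :+ n :^ 2 :+ n) refl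

length-segments : ∀ {A : Set} (x p u q y : List A) →
  length (x ++ (p ++ u ++ q) ++ y) ≡ length x + ((length p + (length u + length q)) + length y)
length-segments x p u q y
  rewrite length-++ x {(p ++ u ++ q) ++ y} | length-++ (p ++ u ++ q) {y}
        | length-++ p {u ++ q} | length-++ u {q} = refl

corollary3 : (k n : ℕ) (M : DFA (Fin k) n) →
    ¬ FactorConvex (Accepts M) →
    Σ (List (Fin k)) λ u → Σ (List (Fin k)) λ v → Σ (List (Fin k)) λ w →
    Witness (Accepts M) u v w ×
    length w + 1 ≤ 3 * n ^ 3 + n ^ 2 + n
corollary3 k n M not-convex =
  let x , |x|<n , p , |p|<n² , u , |u|<n³ , q , |q|<n² , y , |y|<n , witness = short
  in u , p ++ u ++ q , x ++ (p ++ u ++ q) ++ y , witness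
   , ≤-trans (≤-reflexive (cong (_+ 1) (length-segments x p u q y)))
             (segments-bound n |x|<n |p|<n² |u|<n³ |q|<n² |y|<n)
  where
  short : ShortSegmentation M
  short = decidable-stable (short-segmentation? M) λ none → not-convex λ _ _ _ → none ∘ shorten M
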